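{- Let $n\geq2$ and $0\leq k\leq n$. The set of non-smooth signed permutations $\pi\in\mathfrak{B}_n^{+}$ with $\mathrm{des}_B(\pi)=k$ is in bijection with the set of pairs $(u,\sigma)$ with $u\in[n]$ and $\sigma\in\mathfrak{B}_{n-1}^{ - }$ satisfying $\mathrm{des}_B(\sigma)=k$.
   Context: $\mathfrak{B}_m$ is the set of signed permutations $\pi=\pi_1\cdots\pi_m$ of $[m]$; with $\pi_0=0$, $\mathrm{des}_B(\pi)=|\{i\in\{0,\dots,m-1\}:\pi_i>\pi_{i+1}\}|$. $\mathfrak{B}_m^{+}=\{\pi\in\mathfrak{B}_m:\pi_m>0\}$ and $\mathfrak{B}_m^{ - }=\{\pi\in\mathfrak{B}_m:\pi_m<0\}$. A signed permutation $\pi$ is smooth if $\pi_1\cdot\pi_2>0$, and non-smooth otherwise. -}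

module Defs where

open import Data.Nat using (ℕ; zero; suc; _∸_; _≤_)
open import Data.Integer as ℤ using (ℤ; +_; ∣_∣; _*_)
open import Data.Fin using (Fin; toℕ)
open import Data.Vec using (Vec; []; _∷_; toList; lookup)
open import Data.List using (List; []; _∷_)
open import Data.Product using (Σ; _×_; _,_; proj₁)
open import Data.Empty using (⊥)
open import Relation.Nullary using (¬_)
open import Relation.Binary using (Setoid)
open import Relation.Binary.PropositionalEquality using (_≡_; _≢_)
import Relation.Binary.PropositionalEquality as Eq
import Relation.Binary.Construct.On as On
open import Function.Bundles using (Bijection)

-- A word π = π₁ ⋯ πₘ is stored as a vector v with πᵢ = lookup v (i-1).
-- v is a signed permutation of [m] iff every |πᵢ| lies in [m] = {1,…,m}
-- and i ↦ |πᵢ| is injective (hence a permutation of [m]).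
IsSignedPerm : {m : ℕ} → Vec ℤ m → Set
IsSignedPerm {m} v =
  ((i : Fin m) → 1 ≤ ∣ lookup v i ∣ × ∣ lookup v i ∣ ≤ m) ×
  ((i j : Fin m) → ∣ lookup v i ∣ ≡ ∣ lookup v j ∣ → i ≡ j)

descentsFrom : ℤ → List ℤ → ℕ
descentsFrom x []       = 0
descentsFrom x (y ∷ rest) with y ℤ.<? x
... | Relation.Nullary.yes _ = suc (descentsFrom y rest)
... | Relation.Nullary.no  _ = descentsFrom y rest

descents : List ℤ → ℕ
descents []       = 0
descents (x ∷ xs) = descentsFrom x xs

desB : {m : ℕ} → Vec ℤ m → ℕ
desB v = descents (+ 0 ∷ toList v)

LastSat : (ℤ → Set) → List ℤ → Set
LastSat P []             = ⊥
LastSat P (x ∷ [])       = P x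
LastSat P (x ∷ y ∷ rest) = LastSat P (y ∷ rest)

LastPos : {m : ℕ} → Vec ℤ m → Set
LastPos v = LastSat (λ x → + 0 ℤ.< x) (toList v)

LastNeg : {m : ℕ} → Vec ℤ m → Set
LastNeg v = LastSat (λ x → x ℤ.< + 0) (toList v)

Smooth : {m : ℕ} → Vec ℤ m → Set
Smooth (x ∷ y ∷ _) = + 0 ℤ.< x * y
Smooth _           = ⊥

NonSmooth : {m : ℕ} → Vec ℤ m → Set
NonSmooth v = ¬ Smooth v

NonSmoothPlus : ℕ → ℕ → Set
NonSmoothPlus n k =
  Σ (Vec ℤ n) λ v → IsSignedPerm v × LastPos v × NonSmooth v × desB v ≡ k

-- { (u, σ) : u ∈ [n], σ ∈ 𝔅ₙ₋₁⁻, des_B(σ) = k }   (u ∈ [n] encoded as Fin n, u = toℕ + 1)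
PairsMinus : ℕ → ℕ → Set
PairsMinus n k =
  Fin n × Σ (Vec ℤ (n ∸ 1)) λ s → IsSignedPerm s × LastNeg s × desB s ≡ k

NonSmoothPlusSetoid : ℕ → ℕ → Setoid _ _
NonSmoothPlusSetoid n k = record
  { Carrier = NonSmoothPlus n k
  ; _≈_ = λ a b → proj₁ a ≡ proj₁ b
  ; isEquivalence = On.isEquivalence proj₁ Eq.isEquivalence }

pairKey : {n k : ℕ} → PairsMinus n k → Fin n × Vec ℤ (n ∸ 1)
pairKey (u , s , _) = u , s

PairsMinusSetoid : ℕ → ℕ → Setoid _ _
PairsMinusSetoid n k = record
  { Carrier = PairsMinus n k
  ; _≈_ = λ a b → pairKey a ≡ pairKey b
  ; isEquivalence = On.isEquivalence pairKey Eq.isEquivalence }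

{-# OPTIONS --safe #-}
-- Let π = x y ⋯ be non-smooth with positive last letter and put U = |x|.  Every later
-- letter a is replaced by −sgn(a)·(n − st(|a|)), where st : [n] ∖ {U} → [n − 1] is the
-- order-preserving relabelling.  This map reverses signs and preserves the order within
-- each sign class, so an adjacent pair changes its descent status exactly when its
-- entries have opposite signs.  Along y ⋯ these changes telescope, and since x and y
-- have opposite signs and the last letter is positive, dropping x leaves des_B
-- unchanged, while the new last letter is negative.  Conversely, x is recovered from U
-- and the sign of the first new letter.
module Submission where

open import Defs
open import Data.Nat using (ℕ; _≤_)
open import Function.Bundles using (Bijection)

open import Data.Nat.Base
  using (zero; suc; pred; _∸_; _+_; _<_; z≤n; s≤s; z<s; s<s; s≤s⁻¹; s<s⁻¹; >-nonZero)
import Data.Nat.Properties as ℕ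
open import Data.Integer.Base as ℤ using (ℤ; +_; -[1+_]; ∣_∣; sign; _◃_; +<+; -<+; -<-)
import Data.Integer.Properties as ℤ
open import Data.Sign.Base as Sign using (opposite)
open import Data.Sign.Properties using (opposite-involutive)
open import Data.Fin.Base using (Fin; toℕ; fromℕ<; zero; suc)
import Data.Fin.Properties as Fin
open import Data.Vec.Base using (Vec; []; _∷_; toList; lookup; map; head)
open import Data.Vec.Properties using (lookup-map)
open import Data.Vec.Relation.Unary.All as All using (All; []; _∷_)
open import Data.Vec.Relation.Unary.All.Properties using (lookup⁻; lookup⁺; map⁺)
open import Data.List.Base using ([]; _∷_)
open import Data.Product.Base using (_×_; _,_; proj₁; proj₂)
open import Function.Base using (_∘_)
open import Function.Bundles using (Inverse)
open import Function.Properties.Inverse using (Inverse⇒Bijection)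
import Function.Consequences.Setoid as Consequences
open import Relation.Nullary using (¬_; Dec; yes; no; contradiction)
open import Relation.Binary.Definitions using (tri<; tri≈; tri>)
open import Relation.Binary.PropositionalEquality
  using (_≡_; _≢_; refl; sym; trans; cong; cong₂; subst; subst₂; module ≡-Reasoning)
open import Algebra.Properties.CommutativeSemigroup ℕ.+-commutativeSemigroup using (x∙yz≈yx∙z)

private
  variable
    P Q : Set
    k m : ℕ
    a b u : ℕ
    x y : ℤ

⟦_⟧ : Dec P → ℕ
⟦ yes _ ⟧ = 1
⟦ no  _ ⟧ = 0

⟦⟧-yes : P → (p? : Dec P) → ⟦ p? ⟧ ≡ 1
⟦⟧-yes p (yes _) = refl
⟦⟧-yes p (no ¬p) = contradiction p ¬p

⟦⟧-no : ¬ P → (p? : Dec P) → ⟦ p? ⟧ ≡ 0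
⟦⟧-no ¬p (yes p) = contradiction p ¬p
⟦⟧-no ¬p (no _)  = refl

⟦⟧-cong : (P → Q) → (Q → P) → (p? : Dec P) (q? : Dec Q) → ⟦ p? ⟧ ≡ ⟦ q? ⟧
⟦⟧-cong P→Q Q→P (yes p) q? = sym (⟦⟧-yes (P→Q p) q?)
⟦⟧-cong P→Q Q→P (no ¬p) q? = sym (⟦⟧-no (¬p ∘ Q→P) q?)

descentsFrom-∷ : ∀ x y ys → descentsFrom x (y ∷ ys) ≡ ⟦ y ℤ.<? x ⟧ + descentsFrom y ys
descentsFrom-∷ x y ys with y ℤ.<? x
... | yes _ = refl
... | no  _ = refl

InRange : ℕ → ℕ → Set
InRange m a = 1 ≤ a × a ≤ m

Punctured : ℕ → ℕ → ℕ → Set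
Punctured m u a = InRange m a × a ≢ u

punchOutℕ : ℕ → ℕ → ℕ
punchOutℕ zero    a       = pred a
punchOutℕ (suc u) zero    = zero
punchOutℕ (suc u) (suc a) = suc (punchOutℕ u a)

punchInℕ : ℕ → ℕ → ℕ
punchInℕ zero    c       = suc c
punchInℕ (suc u) zero    = zero
punchInℕ (suc u) (suc c) = suc (punchInℕ u c)

punchInℕ-punchOutℕ : a ≢ u → punchInℕ u (punchOutℕ u a) ≡ a
punchInℕ-punchOutℕ {zero}  {zero}  a≢u = contradiction refl a≢u
punchInℕ-punchOutℕ {suc a} {zero}  _   = refl
punchInℕ-punchOutℕ {zero}  {suc u} _   = refl
punchInℕ-punchOutℕ {suc a} {suc u} a≢u = cong suc (punchInℕ-punchOutℕ (a≢u ∘ cong suc))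

punchOutℕ-punchInℕ : ∀ u c → punchOutℕ u (punchInℕ u c) ≡ c
punchOutℕ-punchInℕ zero    c       = refl
punchOutℕ-punchInℕ (suc u) zero    = refl
punchOutℕ-punchInℕ (suc u) (suc c) = cong suc (punchOutℕ-punchInℕ u c)

punchInℕ-≢ : ∀ u c → punchInℕ u c ≢ u
punchInℕ-≢ zero    c       ()
punchInℕ-≢ (suc u) zero    ()
punchInℕ-≢ (suc u) (suc c) eq = punchInℕ-≢ u c (ℕ.suc-injective eq)

≤-punchInℕ : ∀ u c → c ≤ punchInℕ u c
≤-punchInℕ zero    c       = ℕ.n≤1+n c
≤-punchInℕ (suc u) zero    = z≤n
≤-punchInℕ (suc u) (suc c) = s≤s (≤-punchInℕ u c)

punchInℕ-≤ : ∀ u c → punchInℕ u c ≤ suc c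
punchInℕ-≤ zero    c       = ℕ.≤-refl
punchInℕ-≤ (suc u) zero    = z≤n
punchInℕ-≤ (suc u) (suc c) = s≤s (punchInℕ-≤ u c)

punchInℕ-range : ∀ u {c} → InRange m c → InRange (suc m) (punchInℕ u c)
punchInℕ-range u {c} (1≤c , c≤m) =
  ℕ.≤-trans 1≤c (≤-punchInℕ u c) , ℕ.≤-trans (punchInℕ-≤ u c) (s≤s c≤m)

punchOutℕ-positive : 0 < u → 0 < a → 0 < punchOutℕ u a
punchOutℕ-positive {suc u} {suc a} _ _ = z<s

punchOutℕ-< : a ≤ m → u ≤ m → a ≢ u → punchOutℕ u a < m
punchOutℕ-< {zero}  {_}     {zero}  _   _   a≢u = contradiction refl a≢u
punchOutℕ-< {suc a} {_}     {zero}  a≤m _   _   = a≤m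
punchOutℕ-< {zero}  {suc m} {suc u} _   _   _   = z<s
punchOutℕ-< {suc a} {suc m} {suc u} a≤m u≤m a≢u =
  s<s (punchOutℕ-< (s≤s⁻¹ a≤m) (s≤s⁻¹ u≤m) (a≢u ∘ cong suc))

punchOutℕ-mono-< : a ≢ u → b ≢ u → a < b → punchOutℕ u a < punchOutℕ u b
punchOutℕ-mono-< {zero}  {zero}  a≢u _   _   = contradiction refl a≢u
punchOutℕ-mono-< {suc a} {zero}  {suc b} _ _ a<b = s<s⁻¹ a<b
punchOutℕ-mono-< {zero}  {suc u} {suc b} _ _ _   = z<s
punchOutℕ-mono-< {suc a} {suc u} {suc b} a≢u b≢u a<b =
  s<s (punchOutℕ-mono-< (a≢u ∘ cong suc) (b≢u ∘ cong suc) (s<s⁻¹ a<b))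

reflect-range : InRange m a → InRange m (suc m ∸ a)
reflect-range {m} (1≤a , a≤m) = ℕ.m<n⇒0<n∸m (s≤s a≤m) , ℕ.∸-monoʳ-≤ (suc m) 1≤a

data Opposite : ℤ → ℤ → Set where
  +- : Opposite (+ suc a) -[1+ b ]
  -+ : Opposite -[1+ a ] (+ suc b)

nonSmooth⇒opposite : 0 < ∣ x ∣ → 0 < ∣ y ∣ → ¬ (+ 0 ℤ.< x ℤ.* y) → Opposite x y
nonSmooth⇒opposite {+ suc _}  {+ suc _}  _ _ ns = contradiction (+<+ z<s) ns
nonSmooth⇒opposite {+ suc _}  { -[1+ _ ]} _ _ _ = +-
nonSmooth⇒opposite { -[1+ _ ]} {+ suc _}  _ _ _ = -+
nonSmooth⇒opposite { -[1+ _ ]} { -[1+ _ ]} _ _ ns = contradiction (+<+ z<s) ns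

opposite⇒nonSmooth : Opposite x y → ¬ (+ 0 ℤ.< x ℤ.* y)
opposite⇒nonSmooth +- ()
opposite⇒nonSmooth -+ ()

opposite-sign : Opposite x y → sign x ≡ opposite (sign y)
opposite-sign +- = refl
opposite-sign -+ = refl

opposite-descents : Opposite x y → ⟦ x ℤ.<? + 0 ⟧ + ⟦ y ℤ.<? x ⟧ ≡ 1
opposite-descents {x} {y} +- = cong₂ _+_ (⟦⟧-no ℤ.+≮0 (x ℤ.<? + 0)) (⟦⟧-yes -<+ (y ℤ.<? x))
opposite-descents {x} {y} -+ = cong₂ _+_ (⟦⟧-yes -<+ (x ℤ.<? + 0)) (⟦⟧-no ℤ.+≮- (y ℤ.<? x))

◃-opposite : ∀ s → 0 < a → 0 < b → Opposite (s ◃ a) (opposite s ◃ b)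
◃-opposite Sign.+ z<s z<s = +-
◃-opposite Sign.- z<s z<s = -+

neg◃-mono-< : a < b → Sign.- ◃ b ℤ.< Sign.- ◃ a
neg◃-mono-< {a} {b} a<b =
  subst₂ ℤ._<_ (sym (ℤ.-◃n≡-n b)) (sym (ℤ.-◃n≡-n a)) (ℤ.neg-mono-< (+<+ a<b))

signSwap : (ℕ → ℕ) → ℤ → ℤ
signSwap θ x = opposite (sign x) ◃ θ ∣ x ∣

module _ (θ : ℕ → ℕ) where

  sign-signSwap : 0 < θ ∣ x ∣ → sign (signSwap θ x) ≡ opposite (sign x)
  sign-signSwap {x} θ>0 = ℤ.sign-◃ (opposite (sign x)) (θ ∣ x ∣) {{>-nonZero θ>0}}

  signSwap-inverse : ∀ ψ → 0 < θ ∣ x ∣ → ψ (θ ∣ x ∣) ≡ ∣ x ∣ → signSwap ψ (signSwap θ x) ≡ x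
  signSwap-inverse {x} ψ θ>0 ψθ≡id = begin
    opposite (sign (signSwap θ x)) ◃ ψ ∣ signSwap θ x ∣
      ≡⟨ cong₂ (λ s a → opposite s ◃ ψ a) (sign-signSwap θ>0) (ℤ.abs-◃ _ _) ⟩
    opposite (opposite (sign x)) ◃ ψ (θ ∣ x ∣)
      ≡⟨ cong₂ _◃_ (opposite-involutive (sign x)) ψθ≡id ⟩
    sign x ◃ ∣ x ∣
      ≡⟨ ℤ.◃-inverse x ⟩
    x ∎
    where open ≡-Reasoning

  signSwap-positive : 0 < θ ∣ x ∣ → x ℤ.< + 0 → + 0 ℤ.< signSwap θ x
  signSwap-positive { -[1+ _ ]} θ>0 _ = ℤ.+◃-mono-< θ>0
  signSwap-positive {+ _}       _   (+<+ ())

  signSwap-negative : 0 < θ ∣ x ∣ → + 0 ℤ.< x → signSwap θ x ℤ.< + 0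
  signSwap-negative {+ suc p} θ>0 _ = ℤ.-◃<+◃ (θ (suc p)) 0 {{>-nonZero θ>0}}
  signSwap-negative {+ zero}  _   (+<+ ())

module SignSwapDescents
  (D : ℕ → Set) (θ : ℕ → ℕ)
  (D-positive : ∀ {a} → D a → 0 < a)
  (θ-positive : ∀ {a} → D a → 0 < θ a)
  (θ-decreasing : ∀ {a b} → D a → D b → a < b → θ b < θ a)
  where

  private
    φ : ℤ → ℤ
    φ = signSwap θ

  θ-reflects : D a → D b → θ a < θ b → b < a
  θ-reflects {a} {b} da db θa<θb with ℕ.<-cmp a b
  ... | tri< a<b _ _ = contradiction (θ-decreasing da db a<b) (ℕ.<-asym θa<θb)
  ... | tri≈ _ refl _ = contradiction θa<θb (ℕ.<-irrefl refl)
  ... | tri> _ _ b<a = b<a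

  descent-signSwap : D ∣ x ∣ → D ∣ y ∣ →
    ⟦ φ y ℤ.<? φ x ⟧ + ⟦ + 0 ℤ.<? x ⟧ ≡ ⟦ y ℤ.<? x ⟧ + ⟦ + 0 ℤ.<? y ⟧
  descent-signSwap {+ zero} dx _ = contradiction (D-positive dx) (λ ())
  descent-signSwap {_} {+ zero} _ dy = contradiction (D-positive dy) (λ ())
  descent-signSwap {x@(+ suc p)} {y@(+ suc q)} dx dy = cong₂ _+_
    (⟦⟧-cong (λ φy<φx → +<+ (θ-reflects dx dy (ℤ.neg◃-cancel-< φy<φx)))
             (λ { (+<+ y<x) → neg◃-mono-< (θ-decreasing dy dx y<x) })
             (φ y ℤ.<? φ x) (y ℤ.<? x))
    (⟦⟧-cong (λ _ → +<+ z<s) (λ _ → +<+ z<s) (+ 0 ℤ.<? x) (+ 0 ℤ.<? y))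
  descent-signSwap {x@(-[1+ p ])} {y@(-[1+ q ])} dx dy = cong₂ _+_
    (⟦⟧-cong (λ φy<φx → -<- (s<s⁻¹ (θ-reflects dy dx (ℤ.+◃-cancel-< φy<φx))))
             (λ { (-<- p<q) → ℤ.+◃-mono-< (θ-decreasing dx dy (s<s p<q)) })
             (φ y ℤ.<? φ x) (y ℤ.<? x))
    (⟦⟧-cong (λ ()) (λ ()) (+ 0 ℤ.<? x) (+ 0 ℤ.<? y))
  descent-signSwap {x@(+ suc p)} {y@(-[1+ q ])} dx dy = trans
    (cong₂ _+_ (⟦⟧-no ℤ.+◃≮-◃ (φ y ℤ.<? φ x)) (⟦⟧-yes (+<+ z<s) (+ 0 ℤ.<? x)))
    (sym (cong₂ _+_ (⟦⟧-yes -<+ (y ℤ.<? x)) (⟦⟧-no (λ ()) (+ 0 ℤ.<? y))))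
  descent-signSwap {x@(-[1+ p ])} {y@(+ suc q)} dx dy = trans
    (cong₂ _+_ (⟦⟧-yes (ℤ.-◃<+◃ (θ (suc q)) (θ (suc p)) {{>-nonZero (θ-positive dy)}})
                       (φ y ℤ.<? φ x))
               (⟦⟧-no (λ ()) (+ 0 ℤ.<? x)))
    (sym (cong₂ _+_ (⟦⟧-no (λ ()) (y ℤ.<? x)) (⟦⟧-yes (+<+ z<s) (+ 0 ℤ.<? y))))

  initialDescent-signSwap : D ∣ y ∣ → ⟦ φ y ℤ.<? + 0 ⟧ ≡ ⟦ + 0 ℤ.<? y ⟧
  initialDescent-signSwap {+ zero} dy = contradiction (D-positive dy) (λ ())
  initialDescent-signSwap {y@(+ suc _)} dy =
    ⟦⟧-cong (λ _ → +<+ z<s) (signSwap-negative θ (θ-positive dy)) (φ y ℤ.<? + 0) (+ 0 ℤ.<? y)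
  initialDescent-signSwap {y@(-[1+ _ ])} dy =
    ⟦⟧-cong (λ φy<0 → contradiction φy<0 (ℤ.<-asym (signSwap-positive θ (θ-positive dy) -<+)))
            (λ ())
            (φ y ℤ.<? + 0) (+ 0 ℤ.<? y)

  descentsFrom-signSwap : {v : Vec ℤ k} → All (D ∘ ∣_∣) (y ∷ v) → LastPos (y ∷ v) →
    ⟦ + 0 ℤ.<? y ⟧ + descentsFrom (φ y) (toList (map φ v)) ≡ suc (descentsFrom y (toList v))
  descentsFrom-signSwap {y = y} {v = []} _ y>0 = trans (ℕ.+-identityʳ _) (⟦⟧-yes y>0 (+ 0 ℤ.<? y))
  descentsFrom-signSwap {y = y} {v = z ∷ v} (dy ∷ dz ∷ dv) last = begin
    ⟦ + 0 ℤ.<? y ⟧ + descentsFrom (φ y) (φ z ∷ toList (map φ v))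
      ≡⟨ cong (_+_ ⟦ + 0 ℤ.<? y ⟧) (descentsFrom-∷ (φ y) (φ z) _) ⟩
    ⟦ + 0 ℤ.<? y ⟧ + (⟦ φ z ℤ.<? φ y ⟧ + rest)
      ≡⟨ x∙yz≈yx∙z ⟦ + 0 ℤ.<? y ⟧ ⟦ φ z ℤ.<? φ y ⟧ rest ⟩
    (⟦ φ z ℤ.<? φ y ⟧ + ⟦ + 0 ℤ.<? y ⟧) + rest
      ≡⟨ cong (_+ rest) (descent-signSwap dy dz) ⟩
    (⟦ z ℤ.<? y ⟧ + ⟦ + 0 ℤ.<? z ⟧) + rest
      ≡⟨ ℕ.+-assoc ⟦ z ℤ.<? y ⟧ ⟦ + 0 ℤ.<? z ⟧ rest ⟩
    ⟦ z ℤ.<? y ⟧ + (⟦ + 0 ℤ.<? z ⟧ + rest)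
      ≡⟨ cong (_+_ ⟦ z ℤ.<? y ⟧) (descentsFrom-signSwap (dz ∷ dv) last) ⟩
    ⟦ z ℤ.<? y ⟧ + suc (descentsFrom z (toList v))
      ≡⟨ ℕ.+-suc ⟦ z ℤ.<? y ⟧ (descentsFrom z (toList v)) ⟩
    suc (⟦ z ℤ.<? y ⟧ + descentsFrom z (toList v))
      ≡⟨ cong suc (descentsFrom-∷ y z _) ⟨
    suc (descentsFrom y (z ∷ toList v)) ∎
    where
      open ≡-Reasoning
      rest = descentsFrom (φ z) (toList (map φ v))

  desB-signSwap : {v : Vec ℤ k} → Opposite x y → All (D ∘ ∣_∣) (y ∷ v) → LastPos (y ∷ v) →
    desB (x ∷ y ∷ v) ≡ desB (map φ (y ∷ v))
  desB-signSwap {x = x} {y = y} {v = v} opp dom@(dy ∷ _) last = begin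
    descentsFrom (+ 0) (x ∷ y ∷ toList v)
      ≡⟨ descentsFrom-∷ (+ 0) x _ ⟩
    ⟦ x ℤ.<? + 0 ⟧ + descentsFrom x (y ∷ toList v)
      ≡⟨ cong (_+_ ⟦ x ℤ.<? + 0 ⟧) (descentsFrom-∷ x y _) ⟩
    ⟦ x ℤ.<? + 0 ⟧ + (⟦ y ℤ.<? x ⟧ + rest)
      ≡⟨ ℕ.+-assoc ⟦ x ℤ.<? + 0 ⟧ ⟦ y ℤ.<? x ⟧ rest ⟨
    (⟦ x ℤ.<? + 0 ⟧ + ⟦ y ℤ.<? x ⟧) + rest
      ≡⟨ cong (_+ rest) (opposite-descents opp) ⟩
    suc rest
      ≡⟨ descentsFrom-signSwap dom last ⟨
    ⟦ + 0 ℤ.<? y ⟧ + restφ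
      ≡⟨ cong (_+ restφ) (initialDescent-signSwap dy) ⟨
    ⟦ φ y ℤ.<? + 0 ⟧ + restφ
      ≡⟨ descentsFrom-∷ (+ 0) (φ y) _ ⟨
    descentsFrom (+ 0) (φ y ∷ toList (map φ v)) ∎
    where
      open ≡-Reasoning
      rest = descentsFrom y (toList v)
      restφ = descentsFrom (φ y) (toList (map φ v))

AbsInjective : Vec ℤ k → Set
AbsInjective v = ∀ i j → ∣ lookup v i ∣ ≡ ∣ lookup v j ∣ → i ≡ j

isSignedPerm-∷⁻ : {v : Vec ℤ k} → IsSignedPerm (x ∷ v) →
  InRange (suc k) ∣ x ∣ × (∀ i → Punctured (suc k) ∣ x ∣ ∣ lookup v i ∣) × AbsInjective v
isSignedPerm-∷⁻ (range , inj) =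
  range zero ,
  (λ i → range (suc i) , λ eq → Fin.0≢1+n (sym (inj (suc i) zero eq))) ,
  (λ i j eq → Fin.suc-injective (inj (suc i) (suc j) eq))

isSignedPerm-∷⁺ : {v : Vec ℤ k} → ∣ x ∣ ≡ u → InRange (suc k) u →
  (∀ i → Punctured (suc k) u ∣ lookup v i ∣) → AbsInjective v → IsSignedPerm (x ∷ v)
isSignedPerm-∷⁺ {k} {x} {v = v} refl x∈ v∈ inj = range , inj′
  where
    range : ∀ i → InRange (suc k) ∣ lookup (x ∷ v) i ∣
    range zero    = x∈
    range (suc i) = proj₁ (v∈ i)
    inj′ : AbsInjective (x ∷ v)
    inj′ zero    zero    _  = refl
    inj′ zero    (suc j) eq = contradiction (sym eq) (proj₂ (v∈ j))
    inj′ (suc i) zero    eq = contradiction eq (proj₂ (v∈ i))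
    inj′ (suc i) (suc j) eq = cong suc (inj i j eq)

∣lookup-map-signSwap∣ : ∀ θ (v : Vec ℤ k) i → ∣ lookup (map (signSwap θ) v) i ∣ ≡ θ ∣ lookup v i ∣
∣lookup-map-signSwap∣ θ v i = trans (cong ∣_∣ (lookup-map i (signSwap θ) v)) (ℤ.abs-◃ _ _)

signSwap-absInjective : ∀ θ (v : Vec ℤ k) →
  (∀ i j → θ ∣ lookup v i ∣ ≡ θ ∣ lookup v j ∣ → i ≡ j) → AbsInjective (map (signSwap θ) v)
signSwap-absInjective θ v inj i j eq =
  inj i j (trans (sym (∣lookup-map-signSwap∣ θ v i)) (trans eq (∣lookup-map-signSwap∣ θ v j)))

signSwap-isSignedPerm : ∀ θ (v : Vec ℤ k) → (∀ i → InRange k (θ ∣ lookup v i ∣)) →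
  (∀ i j → θ ∣ lookup v i ∣ ≡ θ ∣ lookup v j ∣ → i ≡ j) → IsSignedPerm (map (signSwap θ) v)
signSwap-isSignedPerm {k} θ v range inj =
  (λ i → subst (InRange k) (sym (∣lookup-map-signSwap∣ θ v i)) (range i)) ,
  signSwap-absInjective θ v inj

LastSat-map : {P Q R : ℤ → Set} {φ : ℤ → ℤ} {v : Vec ℤ k} →
  (∀ {a} → R a → P a → Q (φ a)) → All R v → LastSat P (toList v) → LastSat Q (toList (map φ v))
LastSat-map PQ (r ∷ [])           p = PQ r p
LastSat-map PQ (_ ∷ rs@(_ ∷ _)) p = LastSat-map PQ rs p

map-∘-cancel : {f g : ℤ → ℤ} {v : Vec ℤ k} → All (λ a → g (f a) ≡ a) v → map g (map f v) ≡ v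
map-∘-cancel []       = refl
map-∘-cancel (e ∷ es) = cong₂ _∷_ e (map-∘-cancel es)

collapse : ℕ → ℕ → ℕ → ℕ
collapse M u a = suc M ∸ punchOutℕ u a

expand : ℕ → ℕ → ℕ → ℕ
expand M u b = punchInℕ u (suc M ∸ b)

module Collapse (M U : ℕ) (U∈ : InRange (suc M) U) where

  punchOutℕ-range : Punctured (suc M) U a → InRange M (punchOutℕ U a)
  punchOutℕ-range ((1≤a , a≤1+M) , a≢U) =
    punchOutℕ-positive (proj₁ U∈) 1≤a , s≤s⁻¹ (punchOutℕ-< a≤1+M (proj₂ U∈) a≢U)

  collapse-range : Punctured (suc M) U a → InRange M (collapse M U a)
  collapse-range = reflect-range ∘ punchOutℕ-range

  collapse-decreasing : Punctured (suc M) U a → Punctured (suc M) U b → a < b →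
    collapse M U b < collapse M U a
  collapse-decreasing (_ , a≢U) b∈@(_ , b≢U) a<b =
    ℕ.∸-monoʳ-< (punchOutℕ-mono-< a≢U b≢U a<b) (ℕ.m≤n⇒m≤1+n (proj₂ (punchOutℕ-range b∈)))

  expand-punctured : InRange M b → Punctured (suc M) U (expand M U b)
  expand-punctured b∈ = punchInℕ-range U (reflect-range b∈) , punchInℕ-≢ U _

  expand-collapse : Punctured (suc M) U a → expand M U (collapse M U a) ≡ a
  expand-collapse a∈@(_ , a≢U) = trans
    (cong (punchInℕ U) (ℕ.m∸[m∸n]≡n (ℕ.m≤n⇒m≤1+n (proj₂ (punchOutℕ-range a∈)))))
    (punchInℕ-punchOutℕ a≢U)

  collapse-expand : InRange M b → collapse M U (expand M U b) ≡ b
  collapse-expand (_ , b≤M) = trans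
    (cong (suc M ∸_) (punchOutℕ-punchInℕ U _))
    (ℕ.m∸[m∸n]≡n (ℕ.m≤n⇒m≤1+n b≤M))

  collapse-injective : Punctured (suc M) U a → Punctured (suc M) U b →
    collapse M U a ≡ collapse M U b → a ≡ b
  collapse-injective a∈ b∈ eq =
    trans (sym (expand-collapse a∈)) (trans (cong (expand M U) eq) (expand-collapse b∈))

  expand-injective : InRange M a → InRange M b → expand M U a ≡ expand M U b → a ≡ b
  expand-injective a∈ b∈ eq =
    trans (sym (collapse-expand a∈)) (trans (cong (collapse M U) eq) (collapse-expand b∈))

  open SignSwapDescents (Punctured (suc M) U) (collapse M U)
    (proj₁ ∘ proj₁) (proj₁ ∘ collapse-range) collapse-decreasing public

joinWord : (m U : ℕ) → Vec ℤ (suc m) → Vec ℤ (suc (suc m))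
joinWord m U σ = (sign (head σ) ◃ U) ∷ map (signSwap (expand (suc m) U)) σ

module CollapseWords (m U : ℕ) (U∈ : InRange (suc (suc m)) U) where

  open Collapse (suc m) U U∈ public

  private
    collapseU expandU : ℕ → ℕ
    collapseU = collapse (suc m) U
    expandU   = expand (suc m) U

    f g : ℤ → ℤ
    f = signSwap collapseU
    g = signSwap expandU

  Collapsible : ℤ → Set
  Collapsible x = Punctured (suc (suc m)) U ∣ x ∣

  expand-collapsible : InRange (suc m) ∣ x ∣ → Collapsible (g x)
  expand-collapsible x∈ = subst (Punctured (suc (suc m)) U) (sym (ℤ.abs-◃ _ _)) (expand-punctured x∈)

  expand-positive : InRange (suc m) b → 0 < expandU b
  expand-positive = proj₁ ∘ proj₁ ∘ expand-punctured

  collapse-isSignedPerm : {w : Vec ℤ (suc m)} → (∀ i → Collapsible (lookup w i)) → AbsInjective w →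
    IsSignedPerm (map f w)
  collapse-isSignedPerm {w} w∈ inj = signSwap-isSignedPerm collapseU w
    (collapse-range ∘ w∈) (λ i j eq → inj i j (collapse-injective (w∈ i) (w∈ j) eq))

  collapse-lastNeg : {w : Vec ℤ (suc m)} → All Collapsible w → LastPos w → LastNeg (map f w)
  collapse-lastNeg = LastSat-map (λ x∈ → signSwap-negative collapseU (proj₁ (collapse-range x∈)))

  expand∘collapse : {w : Vec ℤ (suc m)} → All Collapsible w → map g (map f w) ≡ w
  expand∘collapse w∈ = map-∘-cancel (All.map
    (λ x∈ → signSwap-inverse collapseU expandU (proj₁ (collapse-range x∈)) (expand-collapse x∈)) w∈)

  collapse∘expand : {σ : Vec ℤ (suc m)} → All (InRange (suc m) ∘ ∣_∣) σ → map f (map g σ) ≡ σ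
  collapse∘expand σ∈ = map-∘-cancel (All.map
    (λ x∈ → signSwap-inverse expandU collapseU (expand-positive x∈) (collapse-expand x∈)) σ∈)

  joinWord-collapse : ∀ {y r} → ∣ x ∣ ≡ U → Opposite x y → All Collapsible (y ∷ r) →
    joinWord m U (map f (y ∷ r)) ≡ x ∷ y ∷ r
  joinWord-collapse {x} {y} ∣x∣≡U opp dom@(y∈ ∷ _) =
    cong₂ _∷_ (ℤ.◃-cong sign≡ abs≡) (expand∘collapse dom)
    where
      sign≡ : sign (sign (f y) ◃ U) ≡ sign x
      sign≡ = begin
        sign (sign (f y) ◃ U) ≡⟨ ℤ.sign-◃ (sign (f y)) U {{>-nonZero (proj₁ U∈)}} ⟩
        sign (f y)            ≡⟨ sign-signSwap collapseU (proj₁ (collapse-range y∈)) ⟩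
        opposite (sign y)     ≡⟨ opposite-sign opp ⟨
        sign x                ∎
        where open ≡-Reasoning
      abs≡ : ∣ sign (f y) ◃ U ∣ ≡ ∣ x ∣
      abs≡ = trans (ℤ.abs-◃ _ U) (sym ∣x∣≡U)

  module _ {s : ℤ} {t : Vec ℤ m} (σ-perm : IsSignedPerm (s ∷ t)) where

    private
      σ∈ : All (InRange (suc m) ∘ ∣_∣) (s ∷ t)
      σ∈ = lookup⁻ (proj₁ σ-perm)

      gσ∈ : All Collapsible (map g (s ∷ t))
      gσ∈ = map⁺ (All.map expand-collapsible σ∈)

    joinWord-opposite : Opposite (sign s ◃ U) (g s)
    joinWord-opposite = ◃-opposite (sign s) (proj₁ U∈) (expand-positive (proj₁ σ-perm zero))

    joinWord-isSignedPerm : IsSignedPerm (joinWord m U (s ∷ t))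
    joinWord-isSignedPerm = isSignedPerm-∷⁺ (ℤ.abs-◃ (sign s) U) U∈ (lookup⁺ gσ∈)
      (signSwap-absInjective expandU (s ∷ t) (λ i j eq →
        proj₂ σ-perm i j (expand-injective (proj₁ σ-perm i) (proj₁ σ-perm j) eq)))

    joinWord-lastPos : LastNeg (s ∷ t) → LastPos (joinWord m U (s ∷ t))
    joinWord-lastPos = LastSat-map (λ x∈ → signSwap-positive expandU (expand-positive x∈)) σ∈

    joinWord-nonSmooth : NonSmooth (joinWord m U (s ∷ t))
    joinWord-nonSmooth = opposite⇒nonSmooth joinWord-opposite

    joinWord-desB : LastNeg (s ∷ t) → desB (joinWord m U (s ∷ t)) ≡ desB (s ∷ t)
    joinWord-desB last = trans
      (desB-signSwap joinWord-opposite gσ∈ (joinWord-lastPos last))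
      (cong desB (collapse∘expand σ∈))

InRange⇒pred< : InRange m a → pred a < m
InRange⇒pred< {a = suc _} (_ , a≤m) = a≤m

-- The range proof is irrelevant, so that toPair below depends only on the underlying word.
indexOf : ∀ a → .(InRange m a) → Fin m
indexOf a a∈ = fromℕ< (InRange⇒pred< a∈)

suc-toℕ-indexOf : (a∈ : InRange m a) → suc (toℕ (indexOf a a∈)) ≡ a
suc-toℕ-indexOf {a = suc _} _ = cong suc (Fin.toℕ-fromℕ< _)

indexOf-suc-toℕ : .(a∈ : InRange m a) (u : Fin m) → a ≡ suc (toℕ u) → indexOf a a∈ ≡ u
indexOf-suc-toℕ _ u refl = Fin.fromℕ<-toℕ u _

InRange-suc-toℕ : (u : Fin m) → InRange m (suc (toℕ u))
InRange-suc-toℕ u = s≤s z≤n , Fin.toℕ<n u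

module NonSmoothPairs (m k : ℕ) where

  collapseTail : ℤ → Vec ℤ (suc m) → Vec ℤ (suc m)
  collapseTail x = map (signSwap (collapse (suc m) ∣ x ∣))

  module Split {x y : ℤ} {r : Vec ℤ m}
    (perm : IsSignedPerm (x ∷ y ∷ r)) (nonSmooth : NonSmooth (x ∷ y ∷ r)) where

    x∈ : InRange (suc (suc m)) ∣ x ∣
    x∈ = proj₁ (isSignedPerm-∷⁻ perm)

    open CollapseWords m ∣ x ∣ x∈ public

    tail∈ : ∀ i → Collapsible (lookup (y ∷ r) i)
    tail∈ = proj₁ (proj₂ (isSignedPerm-∷⁻ perm))

    tail-injective : AbsInjective (y ∷ r)
    tail-injective = proj₂ (proj₂ (isSignedPerm-∷⁻ perm))

    xy-opposite : Opposite x y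
    xy-opposite = nonSmooth⇒opposite (proj₁ x∈) (proj₁ (proj₁ (tail∈ zero))) nonSmooth

  toPair : NonSmoothPlus (suc (suc m)) k → PairsMinus (suc (suc m)) k
  toPair (x ∷ y ∷ r , perm , last , nonSmooth , des) =
    indexOf ∣ x ∣ x∈ , collapseTail x (y ∷ r) ,
    collapse-isSignedPerm {y ∷ r} tail∈ tail-injective ,
    collapse-lastNeg {y ∷ r} (lookup⁻ tail∈) last ,
    trans (sym (desB-signSwap xy-opposite (lookup⁻ tail∈) last)) des
    where open Split perm nonSmooth

  fromPair : PairsMinus (suc (suc m)) k → NonSmoothPlus (suc (suc m)) k
  fromPair (u , s ∷ t , perm , last , des) =
    joinWord m (suc (toℕ u)) (s ∷ t) ,
    joinWord-isSignedPerm perm , joinWord-lastPos perm last , joinWord-nonSmooth perm ,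
    trans (joinWord-desB perm last) des
    where open CollapseWords m (suc (toℕ u)) (InRange-suc-toℕ u)

  toPair-cong : ∀ {π π′} → proj₁ π ≡ proj₁ π′ → pairKey (toPair π) ≡ pairKey (toPair π′)
  toPair-cong {_ ∷ _ ∷ _ , _} {_ , _} refl = refl

  fromPair-cong : ∀ {p p′} → pairKey p ≡ pairKey p′ → proj₁ (fromPair p) ≡ proj₁ (fromPair p′)
  fromPair-cong {_ , _ ∷ _ , _} {_ , _} refl = refl

  toPair-fromPair : ∀ p → pairKey (toPair (fromPair p)) ≡ pairKey p
  toPair-fromPair (u , s ∷ t , perm , _) = cong₂ _,_
    (indexOf-suc-toℕ (proj₁ (joinWord-isSignedPerm perm) zero) u ∣x∣≡U)
    (trans (cong (λ V → map (signSwap (collapse (suc m) V)) (joinTail)) ∣x∣≡U)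
           (collapse∘expand (lookup⁻ (proj₁ perm))))
    where
      open CollapseWords m (suc (toℕ u)) (InRange-suc-toℕ u)
      ∣x∣≡U = ℤ.abs-◃ (sign s) (suc (toℕ u))
      joinTail = map (signSwap (expand (suc m) (suc (toℕ u)))) (s ∷ t)

  fromPair-toPair : ∀ π → proj₁ (fromPair (toPair π)) ≡ proj₁ π
  fromPair-toPair (x ∷ y ∷ r , perm , _ , nonSmooth , _) = trans
    (cong (λ U → joinWord m U (collapseTail x (y ∷ r))) (suc-toℕ-indexOf x∈))
    (joinWord-collapse refl xy-opposite (lookup⁻ tail∈))
    where open Split perm nonSmooth

  inverse : Inverse (NonSmoothPlusSetoid (suc (suc m)) k) (PairsMinusSetoid (suc (suc m)) k)
  inverse = record
    { to        = toPair
    ; from      = fromPair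
    ; to-cong   = toPair-cong
    ; from-cong = fromPair-cong
    ; inverse   = strictlyInverseˡ⇒inverseˡ {f = toPair} {f⁻¹ = fromPair}
                    toPair-cong toPair-fromPair
                , strictlyInverseʳ⇒inverseʳ {f⁻¹ = fromPair} {f = toPair}
                    fromPair-cong fromPair-toPair
    }
    where open Consequences (NonSmoothPlusSetoid (suc (suc m)) k) (PairsMinusSetoid (suc (suc m)) k)

-- The bijection exists for every k.
lemma3p2 : (n k : ℕ) → 2 ≤ n → k ≤ n →
    Bijection (NonSmoothPlusSetoid n k) (PairsMinusSetoid n k)
lemma3p2 (suc (suc m)) k (s≤s (s≤s z≤n)) _ = Inverse⇒Bijection (NonSmoothPairs.inverse m k)
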